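{- Let $w,v$ be integers with $2\le w<v$ and $v\ge 2w$. Then an optimal $(\bar{1},1)$-LA$(v;w+1,(w,w,\dots,w,v))$ exists, where the level vector consists of $w$ entries equal to $w$ followed by one entry $v$; i.e. such an array with $v$ rows exists and $v=(\bar1,1)\text{ -LAN}(w+1,(w,\dots,w,v))$.
   Context: For positive integers $N,k,t$ with $t<k$ and $v_1,\dots,v_k$, consider $N\times k$ arrays $A=(a_{rj})$ whose $j$-th column has entries from a set $V_j$ with $|V_j|=v_j$. A $t$-way interaction is $T=\{(j,\sigma_j):j\in I\}$ with $I\subseteq\{1,\dots,k\}$, $|I|=t$, $\sigma_j\in V_j$; $\rho(A,T)$ is the set of rows $r$ with $a_{rj}=\sigma_j$ for all $j\in I$, and $\rho(A,\mathcal T)=\bigcup_{T\in\mathcal T}\rho(A,T)$. $A$ is a $(\bar1,t)$-LA$(N;k,(v_1,\dots,v_k))$ if for all sets $\mathcal T_1,\mathcal T_2$ of $t$-way interactions with $|\mathcal T_1|,|\mathcal T_2|\le 1$: $\rho(A,\mathcal T_1)=\rho(A,\mathcal T_2)\iff\mathcal T_1=\mathcal T_2$ (equivalently: every $t$-way interaction occurs in some row and distinct interactions have distinct $\rho$). $(\bar1,t)$-LAN$(k,(v_1,\dots,v_k))$ is the minimum $N$ for which such an array exists; an LA attaining it is optimal. -}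

module Defs where

open import Data.Nat using (ℕ; suc; _≤_)
open import Data.Fin using (Fin)
open import Data.Fin.Subset using (Subset; _∈_; ∣_∣)
open import Data.Vec using (Vec; lookup; replicate; _∷ʳ_)
open import Data.Maybe using (Maybe; just; nothing)
open import Data.Product using (Σ; _×_; _,_; ∃)
open import Data.Empty using (⊥)
open import Data.Unit using (⊤)
open import Relation.Binary.PropositionalEquality using (_≡_)
open import Function.Bundles using (_⇔_)

Array : (N k : ℕ) → (v : Fin k → ℕ) → Set
Array N k v = Fin N → (j : Fin k) → Fin (v j)

record Interaction (k : ℕ) (v : Fin k → ℕ) (t : ℕ) : Set where
  constructor interaction
  field
    cols  : Subset k
    size  : ∣ cols ∣ ≡ t
    vals  : (j : Fin k) → j ∈ cols → Fin (v j)

open Interaction public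

-- Equality of interactions as sets of pairs (j , σ_j).
SameInteraction : ∀ {k v t} → Interaction k v t → Interaction k v t → Set
SameInteraction T₁ T₂ =
  (cols T₁ ≡ cols T₂) ×
  (∀ j (p : j ∈ cols T₁) (q : j ∈ cols T₂) → vals T₁ j p ≡ vals T₂ j q)

Covers : ∀ {N k v t} → Array N k v → Interaction k v t → Fin N → Set
Covers A T r = ∀ j (p : j ∈ cols T) → A r j ≡ vals T j p

-- A set 𝒯 of t-way interactions with |𝒯| ≤ 1 is represented by Maybe:
-- nothing = ∅, just T = {T}.
-- r ∈ ρ(A,𝒯)
CoversSet : ∀ {N k v t} → Array N k v → Maybe (Interaction k v t) → Fin N → Set
CoversSet A nothing  r = ⊥
CoversSet A (just T) r = Covers A T r

SameSet : ∀ {k v t} → Maybe (Interaction k v t) → Maybe (Interaction k v t) → Set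
SameSet nothing   nothing   = ⊤
SameSet nothing   (just _)  = ⊥
SameSet (just _)  nothing   = ⊥
SameSet (just T₁) (just T₂) = SameInteraction T₁ T₂

SameRows : ∀ {N k v t} → Array N k v →
           Maybe (Interaction k v t) → Maybe (Interaction k v t) → Set
SameRows A 𝒯₁ 𝒯₂ = ∀ r → CoversSet A 𝒯₁ r ⇔ CoversSet A 𝒯₂ r

IsLA : (t : ℕ) → ∀ {N k v} → Array N k v → Set
IsLA t {N} {k} {v} A =
  (𝒯₁ 𝒯₂ : Maybe (Interaction k v t)) → SameRows A 𝒯₁ 𝒯₂ ⇔ SameSet 𝒯₁ 𝒯₂

IsOptimalLA : (t : ℕ) → ∀ {N k v} → Array N k v → Set
IsOptimalLA t {N} {k} {v} A =
  IsLA t A × (∀ M (B : Array M k v) → IsLA t B → N ≤ M)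

levels : (w v : ℕ) → Fin (suc w) → ℕ
levels w v = lookup (replicate w w ∷ʳ v)

-- For t = 1 an array is locating as soon as every value of every column occurs and
-- values in different columns never occupy exactly the same rows. Take the cyclic
-- Latin square (r + c) mod w on the first w rows, put s in each of the first w
-- columns of row w + s, fill the remaining rows arbitrarily (here r mod w), and
-- let the last column be the row index. A value of the last column then occurs in
-- exactly one row, a value of another column in at least two; two of the first w
-- columns sharing a value s agree on row w + s, and the Latin square forces them to
-- be equal. Optimality: the v levels of the last column need v distinct rows.
module Submission where

open import Defs
open import Data.Nat using (ℕ; zero; suc; _+_; _∸_; _*_; _≤_; _<_; _<?_; z≤n; s≤s; NonZero; >-nonZero)
open import Data.Nat.Properties
  using ( ≤-trans; <-≤-trans; <-irrefl; <⇒≤; <⇒≱; +-identityʳ; +-comm; +-assoc; +-monoʳ-<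
        ; m≤m+n; m∸n≤m; m+[n∸m]≡n; m∸[m∸n]≡n)
open import Data.Nat.DivMod using (_%_; _mod_; %-distribˡ-+; m%n%n≡m%n; [m+n]%n≡m%n; m<n⇒m%n≡m; m%n<n)
open import Data.Fin using (Fin; zero; suc; toℕ; fromℕ; fromℕ<; inject₁)
open import Data.Fin.Properties using (toℕ-injective; toℕ-fromℕ<; toℕ<n; injective⇒≤; any?) renaming (_≟_ to _≟ᶠ_)
open import Data.Fin.Relation.Unary.Top using (view; ‵fromℕ; ‵inject₁)
open import Data.Fin.Subset using (Subset; _∈_; _⊆_; ⁅_⁆; ∣_∣; Nonempty)
open import Data.Fin.Subset.Properties
  using (nonempty?; Empty-unique; ∣⊥∣≡0; x∈⁅x⁆; x∈⁅y⁆⇒x≡y; x≢y⇒x∉⁅y⁆; ∣⁅x⁆∣≡1; p⊂q⇒∣p∣<∣q∣; ⊆-antisym)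
open import Data.Vec using (Vec; _∷_; []; lookup; replicate; _∷ʳ_)
open import Data.Vec.Properties using (lookup-replicate)
open import Data.Vec.Properties.WithK using ([]=-irrelevant)
open import Data.Maybe using (Maybe; just; nothing)
open import Data.Product using (Σ; ∃; _,_; proj₁; proj₂)
open import Data.Empty using (⊥-elim)
open import Data.Unit using (tt)
open import Function using (_∘_)
open import Function.Bundles using (_⇔_; mk⇔; Equivalence)
open import Function.Properties.Equivalence using () renaming (refl to ⇔-refl; sym to ⇔-sym; trans to ⇔-trans)
open import Relation.Nullary using (yes; no; ¬_; contradiction)
open import Relation.Binary.PropositionalEquality
  using (_≡_; _≢_; refl; sym; trans; cong; subst; module ≡-Reasoning)

open Equivalence using (to; from)

∣p∣≡1⇒nonempty : ∀ {n} {p : Subset n} → ∣ p ∣ ≡ 1 → Nonempty p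
∣p∣≡1⇒nonempty {n} {p} ∣p∣≡1 with nonempty? p
... | yes p≢∅ = p≢∅
... | no p≡∅ with trans (sym ∣p∣≡1) (trans (cong ∣_∣ (Empty-unique p≡∅)) (∣⊥∣≡0 n))
...   | ()

∣p∣≡1⇒unique : ∀ {n} {p : Subset n} {x y} → ∣ p ∣ ≡ 1 → x ∈ p → y ∈ p → x ≡ y
∣p∣≡1⇒unique {p = p} {x} {y} ∣p∣≡1 x∈p y∈p with y ≟ᶠ x
... | yes y≡x = sym y≡x
... | no y≢x = contradiction (p⊂q⇒∣p∣<∣q∣ (⁅x⁆⊆p , y , y∈p , x≢y⇒x∉⁅y⁆ y≢x))
                             (<-irrefl (trans (∣⁅x⁆∣≡1 x) (sym ∣p∣≡1)))
  where
  ⁅x⁆⊆p : ⁅ x ⁆ ⊆ p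
  ⁅x⁆⊆p z∈⁅x⁆ = subst (_∈ p) (sym (x∈⁅y⁆⇒x≡y x z∈⁅x⁆)) x∈p

∣p∣≡∣q∣≡1⇒p≡q : ∀ {n} {p q : Subset n} {x} → ∣ p ∣ ≡ 1 → ∣ q ∣ ≡ 1 → x ∈ p → x ∈ q → p ≡ q
∣p∣≡∣q∣≡1⇒p≡q {p = p} {q} ∣p∣≡1 ∣q∣≡1 x∈p x∈q = ⊆-antisym
  (λ y∈p → subst (_∈ q) (∣p∣≡1⇒unique ∣p∣≡1 x∈p y∈p) x∈q)
  (λ y∈q → subst (_∈ p) (∣p∣≡1⇒unique ∣q∣≡1 x∈q y∈q) x∈p)

module _ {N k} {v : Fin k → ℕ} (A : Array N k v) where

  Covering : Set
  Covering = ∀ j (σ : Fin (v j)) → ∃ λ r → A r j ≡ σ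

  Separating : Set
  Separating = ∀ {j₁ j₂} (σ₁ : Fin (v j₁)) (σ₂ : Fin (v j₂)) →
    (∀ r → A r j₁ ≡ σ₁ ⇔ A r j₂ ≡ σ₂) → j₁ ≡ j₂

  sameSet⇒sameRows : ∀ {t} (𝒯₁ 𝒯₂ : Maybe (Interaction k v t)) → SameSet 𝒯₁ 𝒯₂ → SameRows A 𝒯₁ 𝒯₂
  sameSet⇒sameRows nothing   nothing   _                r = ⇔-refl
  sameSet⇒sameRows (just T₁) (just T₂) (cols≡ , vals≡) r = mk⇔
    (λ covers j j∈₂ → trans (covers j (subst (j ∈_) (sym cols≡) j∈₂)) (vals≡ j _ j∈₂))
    (λ covers j j∈₁ → trans (covers j (subst (j ∈_) cols≡ j∈₁)) (sym (vals≡ j j∈₁ _)))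

  covers⇔ : (T : Interaction k v 1) {r : Fin N} {j : Fin k} (j∈ : j ∈ cols T) →
            Covers A T r ⇔ (A r j ≡ vals T j j∈)
  covers⇔ T {r} {j} j∈ = mk⇔ (λ covers → covers j j∈) covers
    where
    covers : A r j ≡ vals T j j∈ → Covers A T r
    covers Arj≡ i i∈ with ∣p∣≡1⇒unique (size T) j∈ i∈
    ... | refl rewrite []=-irrelevant i∈ j∈ = Arj≡

  covering⇒covered : Covering → (T : Interaction k v 1) → ∃ (Covers A T)
  covering⇒covered covering T =
    let j , j∈ = ∣p∣≡1⇒nonempty (size T)
        r , Arj≡ = covering j (vals T j j∈)
    in r , from (covers⇔ T j∈) Arj≡

  sameRows⇒sameSet : Covering → Separating →
                     (𝒯₁ 𝒯₂ : Maybe (Interaction k v 1)) → SameRows A 𝒯₁ 𝒯₂ → SameSet 𝒯₁ 𝒯₂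
  sameRows⇒sameSet _ _ nothing nothing _ = tt
  sameRows⇒sameSet covering _ nothing (just T) same =
    let r , covers = covering⇒covered covering T in from (same r) covers
  sameRows⇒sameSet covering _ (just T) nothing same =
    let r , covers = covering⇒covered covering T in to (same r) covers
  sameRows⇒sameSet covering separating (just T₁) (just T₂) same
    with ∣p∣≡1⇒nonempty (size T₁) | ∣p∣≡1⇒nonempty (size T₂)
  ... | j₁ , j₁∈ | j₂ , j₂∈ = cols≡ , vals≡
    where
    j₁≡j₂ : j₁ ≡ j₂
    j₁≡j₂ = separating _ _ λ r → ⇔-trans (⇔-sym (covers⇔ T₁ j₁∈)) (⇔-trans (same r) (covers⇔ T₂ j₂∈))

    cols≡ : cols T₁ ≡ cols T₂
    cols≡ = ∣p∣≡∣q∣≡1⇒p≡q (size T₁) (size T₂) j₁∈ (subst (_∈ cols T₂) (sym j₁≡j₂) j₂∈)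

    vals≡ : ∀ j (j∈₁ : j ∈ cols T₁) (j∈₂ : j ∈ cols T₂) → vals T₁ j j∈₁ ≡ vals T₂ j j∈₂
    vals≡ j j∈₁ j∈₂ =
      let r , Arj≡ = covering j (vals T₁ j j∈₁)
      in trans (sym Arj≡) (to (covers⇔ T₂ j∈₂) (to (same r) (from (covers⇔ T₁ j∈₁) Arj≡)))

  covering∧separating⇒isLA : Covering → Separating → IsLA 1 A
  covering∧separating⇒isLA covering separating 𝒯₁ 𝒯₂ =
    mk⇔ (sameRows⇒sameSet covering separating 𝒯₁ 𝒯₂) (sameSet⇒sameRows 𝒯₁ 𝒯₂)

  singleton : (j : Fin k) → Fin (v j) → Interaction k v 1
  singleton j σ = interaction ⁅ j ⁆ (∣⁅x⁆∣≡1 j) λ i i∈⁅j⁆ → subst (Fin ∘ v) (sym (x∈⁅y⁆⇒x≡y j i∈⁅j⁆)) σ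

  covers-singleton : ∀ {r j} {σ : Fin (v j)} → Covers A (singleton j σ) r → A r j ≡ σ
  -- The match on refl at type j ≡ j uses K.
  covers-singleton {j = j} covers with x∈⁅y⁆⇒x≡y j (x∈⁅x⁆ j) | covers j (x∈⁅x⁆ j)
  ... | refl | Arj≡σ = Arj≡σ

  isLA⇒covering : IsLA 1 A → Covering
  isLA⇒covering isLA j σ with any? (λ r → A r j ≟ᶠ σ)
  ... | yes found = found
  ... | no none = ⊥-elim (to (isLA nothing (just (singleton j σ)))
                              λ r → mk⇔ ⊥-elim (λ covers → none (r , covers-singleton covers)))

  isLA⇒levels≤rows : IsLA 1 A → ∀ j → v j ≤ N
  isLA⇒levels≤rows isLA j = injective⇒≤ {f = proj₁ ∘ covering j} λ {σ} {τ} rσ≡rτ →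
    trans (sym (proj₂ (covering j σ))) (trans (cong (λ r → A r j) rσ≡rτ) (proj₂ (covering j τ)))
    where
    covering : Covering
    covering = isLA⇒covering isLA

lookup-∷ʳ-fromℕ : ∀ {a} {A : Set a} {n} (xs : Vec A n) x → lookup (xs ∷ʳ x) (fromℕ n) ≡ x
lookup-∷ʳ-fromℕ []       x = refl
lookup-∷ʳ-fromℕ (_ ∷ xs) x = lookup-∷ʳ-fromℕ xs x

lookup-∷ʳ-inject₁ : ∀ {a} {A : Set a} {n} (xs : Vec A n) x i → lookup (xs ∷ʳ x) (inject₁ i) ≡ lookup xs i
lookup-∷ʳ-inject₁ (_ ∷ xs) x zero    = refl
lookup-∷ʳ-inject₁ (_ ∷ xs) x (suc i) = lookup-∷ʳ-inject₁ xs x i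

levels-fromℕ : ∀ w v → levels w v (fromℕ w) ≡ v
levels-fromℕ w v = lookup-∷ʳ-fromℕ (replicate w w) v

levels-inject₁ : ∀ {w} v (c : Fin w) → levels w v (inject₁ c) ≡ w
levels-inject₁ {w} v c = trans (lookup-∷ʳ-inject₁ (replicate w w) v c) (lookup-replicate c w)

snoc : ∀ {n a b} → (Fin n → Fin a) → Fin b → (j : Fin (suc n)) → Fin (lookup (replicate n a ∷ʳ b) j)
snoc {zero}  f y zero    = y
snoc {suc n} f y zero    = f zero
snoc {suc n} f y (suc j) = snoc (f ∘ suc) y j

toℕ-snoc-inject₁ : ∀ {n a b} (f : Fin n → Fin a) (y : Fin b) i → toℕ (snoc f y (inject₁ i)) ≡ toℕ (f i)
toℕ-snoc-inject₁ f y zero    = refl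
toℕ-snoc-inject₁ f y (suc i) = toℕ-snoc-inject₁ (f ∘ suc) y i

toℕ-snoc-fromℕ : ∀ {n a b} (f : Fin n → Fin a) (y : Fin b) → toℕ (snoc f y (fromℕ n)) ≡ toℕ y
toℕ-snoc-fromℕ {zero}  f y = refl
toℕ-snoc-fromℕ {suc n} f y = toℕ-snoc-fromℕ (f ∘ suc) y

[m%d+n]%d≡[m+n]%d : ∀ m n d .{{_ : NonZero d}} → (m % d + n) % d ≡ (m + n) % d
[m%d+n]%d≡[m+n]%d m n d = begin
  (m % d + n) % d         ≡⟨ %-distribˡ-+ (m % d) n d ⟩
  (m % d % d + n % d) % d ≡⟨ cong (λ x → (x + n % d) % d) (m%n%n≡m%n m d) ⟩
  (m % d + n % d) % d     ≡⟨ %-distribˡ-+ m n d ⟨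
  (m + n) % d             ∎
  where open ≡-Reasoning

[[n+m]%d+[d∸n]]%d≡m%d : ∀ n m d .{{_ : NonZero d}} → n ≤ d → ((n + m) % d + (d ∸ n)) % d ≡ m % d
[[n+m]%d+[d∸n]]%d≡m%d n m d n≤d = begin
  ((n + m) % d + (d ∸ n)) % d ≡⟨ [m%d+n]%d≡[m+n]%d (n + m) (d ∸ n) d ⟩
  (n + m + (d ∸ n)) % d       ≡⟨ cong (λ x → (x + (d ∸ n)) % d) (+-comm n m) ⟩
  (m + n + (d ∸ n)) % d       ≡⟨ cong (_% d) (+-assoc m n (d ∸ n)) ⟩
  (m + (n + (d ∸ n))) % d     ≡⟨ cong (λ x → (m + x) % d) (m+[n∸m]≡n n≤d) ⟩
  (m + d) % d                 ≡⟨ [m+n]%n≡m%n m d ⟩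
  m % d                       ∎
  where open ≡-Reasoning

[[d∸c+s]%d+c]%d≡s : ∀ c s d .{{_ : NonZero d}} → c ≤ d → s < d → ((d ∸ c + s) % d + c) % d ≡ s
[[d∸c+s]%d+c]%d≡s c s d c≤d s<d = begin
  ((d ∸ c + s) % d + c) % d             ≡⟨ cong (λ x → ((d ∸ c + s) % d + x) % d) (m∸[m∸n]≡n c≤d) ⟨
  ((d ∸ c + s) % d + (d ∸ (d ∸ c))) % d ≡⟨ [[n+m]%d+[d∸n]]%d≡m%d (d ∸ c) s d (m∸n≤m d c) ⟩
  s % d                                 ≡⟨ m<n⇒m%n≡m s<d ⟩
  s                                     ∎
  where open ≡-Reasoning

[a+c]%d-injective : ∀ a {c₁ c₂} d .{{_ : NonZero d}} → a ≤ d → c₁ < d → c₂ < d →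
                    (a + c₁) % d ≡ (a + c₂) % d → c₁ ≡ c₂
[a+c]%d-injective a {c₁} {c₂} d a≤d c₁<d c₂<d eq = begin
  c₁                           ≡⟨ m<n⇒m%n≡m c₁<d ⟨
  c₁ % d                       ≡⟨ [[n+m]%d+[d∸n]]%d≡m%d a c₁ d a≤d ⟨
  ((a + c₁) % d + (d ∸ a)) % d ≡⟨ cong (λ x → (x + (d ∸ a)) % d) eq ⟩
  ((a + c₂) % d + (d ∸ a)) % d ≡⟨ [[n+m]%d+[d∸n]]%d≡m%d a c₂ d a≤d ⟩
  c₂ % d                       ≡⟨ m<n⇒m%n≡m c₂<d ⟩
  c₂                           ∎
  where open ≡-Reasoning

module Cyclic (w v : ℕ) .{{_ : NonZero w}} (w+w≤v : w + w ≤ v) where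

  w≤v : w ≤ v
  w≤v = ≤-trans (m≤m+n w w) w+w≤v

  shift : ℕ → ℕ → ℕ
  shift r c with r <? w
  ... | yes _ = r + c
  ... | no  _ = r

  shift-< : ∀ {r} c → r < w → shift r c ≡ r + c
  shift-< {r} c r<w with r <? w
  ... | yes _   = refl
  ... | no  r≮w = contradiction r<w r≮w

  shift-≥ : ∀ {r} c → w ≤ r → shift r c ≡ r
  shift-≥ {r} c w≤r with r <? w
  ... | yes r<w = contradiction w≤r (<⇒≱ r<w)
  ... | no  _   = refl

  cyclic : Array v (suc w) (levels w v)
  cyclic r = snoc (λ c → shift (toℕ r) (toℕ c) mod w) r

  toℕ-cyclic-inject₁ : ∀ {n} (n<v : n < v) c → toℕ (cyclic (fromℕ< n<v) (inject₁ c)) ≡ shift n (toℕ c) % w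
  toℕ-cyclic-inject₁ {n} n<v c = begin
    toℕ (cyclic (fromℕ< n<v) (inject₁ c))        ≡⟨ toℕ-snoc-inject₁ _ (fromℕ< n<v) c ⟩
    toℕ (shift (toℕ (fromℕ< n<v)) (toℕ c) mod w) ≡⟨ toℕ-fromℕ< _ ⟩
    shift (toℕ (fromℕ< n<v)) (toℕ c) % w         ≡⟨ cong (λ r → shift r (toℕ c) % w) (toℕ-fromℕ< n<v) ⟩
    shift n (toℕ c) % w                          ∎
    where open ≡-Reasoning

  toℕ-cyclic-fromℕ : ∀ r → toℕ (cyclic r (fromℕ w)) ≡ toℕ r
  toℕ-cyclic-fromℕ r = toℕ-snoc-fromℕ {n = w} _ r

  w+s<v : ∀ {s} → s < w → w + s < v
  w+s<v s<w = <-≤-trans (+-monoʳ-< w s<w) w+w≤v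

  constantRow : ∀ {s} → s < w → Fin v
  constantRow s<w = fromℕ< (w+s<v s<w)

  latinRowℕ : Fin w → ℕ → ℕ
  latinRowℕ c s = (w ∸ toℕ c + s) % w

  latinRowℕ<w : ∀ c s → latinRowℕ c s < w
  latinRowℕ<w c s = m%n<n (w ∸ toℕ c + s) w

  latinRowℕ<v : ∀ c s → latinRowℕ c s < v
  latinRowℕ<v c s = <-≤-trans (latinRowℕ<w c s) w≤v

  latinRow : Fin w → ℕ → Fin v
  latinRow c s = fromℕ< (latinRowℕ<v c s)

  constantRow-hits : ∀ {s} (s<w : s < w) c → toℕ (cyclic (constantRow s<w) (inject₁ c)) ≡ s
  constantRow-hits {s} s<w c = begin
    toℕ (cyclic (constantRow s<w) (inject₁ c)) ≡⟨ toℕ-cyclic-inject₁ (w+s<v s<w) c ⟩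
    shift (w + s) (toℕ c) % w                  ≡⟨ cong (_% w) (shift-≥ (toℕ c) (m≤m+n w s)) ⟩
    (w + s) % w                                ≡⟨ cong (_% w) (+-comm w s) ⟩
    (s + w) % w                                ≡⟨ [m+n]%n≡m%n s w ⟩
    s % w                                      ≡⟨ m<n⇒m%n≡m s<w ⟩
    s                                          ∎
    where open ≡-Reasoning

  toℕ-cyclic-latinRow : ∀ c s c′ → toℕ (cyclic (latinRow c s) (inject₁ c′)) ≡ (latinRowℕ c s + toℕ c′) % w
  toℕ-cyclic-latinRow c s c′ =
    trans (toℕ-cyclic-inject₁ (latinRowℕ<v c s) c′) (cong (_% w) (shift-< (toℕ c′) (latinRowℕ<w c s)))

  latinRow-hits : ∀ {s} → s < w → ∀ c → toℕ (cyclic (latinRow c s) (inject₁ c)) ≡ s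
  latinRow-hits {s} s<w c =
    trans (toℕ-cyclic-latinRow c s c) ([[d∸c+s]%d+c]%d≡s (toℕ c) s w (<⇒≤ (toℕ<n c)) s<w)

  latinRow-separates : ∀ {s} → s < w → ∀ c₁ c₂ → toℕ (cyclic (latinRow c₁ s) (inject₁ c₂)) ≡ s → c₁ ≡ c₂
  latinRow-separates {s} s<w c₁ c₂ hits = toℕ-injective
    ([a+c]%d-injective (latinRowℕ c₁ s) w (<⇒≤ (latinRowℕ<w c₁ s)) (toℕ<n c₁) (toℕ<n c₂) (begin
      (latinRowℕ c₁ s + toℕ c₁) % w             ≡⟨ toℕ-cyclic-latinRow c₁ s c₁ ⟨
      toℕ (cyclic (latinRow c₁ s) (inject₁ c₁)) ≡⟨ latinRow-hits s<w c₁ ⟩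
      s                                         ≡⟨ hits ⟨
      toℕ (cyclic (latinRow c₁ s) (inject₁ c₂)) ≡⟨ toℕ-cyclic-latinRow c₁ s c₂ ⟩
      (latinRowℕ c₁ s + toℕ c₂) % w             ∎))
    where open ≡-Reasoning

  latinRow≢constantRow : ∀ {s} (s<w : s < w) c → toℕ (latinRow c s) ≢ toℕ (constantRow s<w)
  latinRow≢constantRow {s} s<w c eq = <⇒≱ (latinRowℕ<w c s)
    (subst (w ≤_) (trans (sym (toℕ-fromℕ< _)) (trans (sym eq) (toℕ-fromℕ< _))) (m≤m+n w s))

  toℕ<w : ∀ c (σ : Fin (levels w v (inject₁ c))) → toℕ σ < w
  toℕ<w c σ = subst (toℕ σ <_) (levels-inject₁ v c) (toℕ<n σ)

  toℕ<v : (σ : Fin (levels w v (fromℕ w))) → toℕ σ < v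
  toℕ<v σ = subst (toℕ σ <_) (levels-fromℕ w v) (toℕ<n σ)

  covering : Covering cyclic
  covering j σ with view j
  ... | ‵fromℕ     = fromℕ< (toℕ<v σ) , toℕ-injective (trans (toℕ-cyclic-fromℕ _) (toℕ-fromℕ< _))
  ... | ‵inject₁ c = constantRow (toℕ<w c σ) , toℕ-injective (constantRow-hits (toℕ<w c σ) c)

  last-column-not-below : ∀ c σ τ → ¬ (∀ r → cyclic r (inject₁ c) ≡ σ → cyclic r (fromℕ w) ≡ τ)
  last-column-not-below c σ τ below = latinRow≢constantRow s<w c (begin
    toℕ (latinRow c s)                       ≡⟨ toℕ-cyclic-fromℕ (latinRow c s) ⟨
    toℕ (cyclic (latinRow c s) (fromℕ w))    ≡⟨ cong toℕ (below _ (toℕ-injective (latinRow-hits s<w c))) ⟩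
    toℕ τ                                    ≡⟨ cong toℕ (below _ (toℕ-injective (constantRow-hits s<w c))) ⟨
    toℕ (cyclic (constantRow s<w) (fromℕ w)) ≡⟨ toℕ-cyclic-fromℕ (constantRow s<w) ⟩
    toℕ (constantRow s<w)                    ∎)
    where
    open ≡-Reasoning
    s : ℕ
    s = toℕ σ
    s<w : s < w
    s<w = toℕ<w c σ

  inner-columns-separated : ∀ c₁ c₂ σ₁ σ₂ →
    (∀ r → cyclic r (inject₁ c₁) ≡ σ₁ → cyclic r (inject₁ c₂) ≡ σ₂) → c₁ ≡ c₂
  inner-columns-separated c₁ c₂ σ₁ σ₂ below = latinRow-separates s₁<w c₁ c₂ (begin
    toℕ (cyclic (latinRow c₁ (toℕ σ₁)) (inject₁ c₂))
      ≡⟨ cong toℕ (below _ (toℕ-injective (latinRow-hits s₁<w c₁))) ⟩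
    toℕ σ₂                                           ≡⟨ s₁≡s₂ ⟨
    toℕ σ₁                                           ∎)
    where
    open ≡-Reasoning
    s₁<w : toℕ σ₁ < w
    s₁<w = toℕ<w c₁ σ₁
    s₁≡s₂ : toℕ σ₁ ≡ toℕ σ₂
    s₁≡s₂ = trans (sym (constantRow-hits s₁<w c₂))
                  (cong toℕ (below _ (toℕ-injective (constantRow-hits s₁<w c₁))))

  separating : Separating cyclic
  separating {j₁} {j₂} σ₁ σ₂ same with view j₁ | view j₂
  ... | ‵fromℕ      | ‵fromℕ      = refl
  ... | ‵fromℕ      | ‵inject₁ c  = ⊥-elim (last-column-not-below c σ₂ σ₁ (λ r → from (same r)))
  ... | ‵inject₁ c  | ‵fromℕ      = ⊥-elim (last-column-not-below c σ₁ σ₂ (λ r → to (same r)))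
  ... | ‵inject₁ c₁ | ‵inject₁ c₂ = cong inject₁ (inner-columns-separated c₁ c₂ σ₁ σ₂ (λ r → to (same r)))

  cyclic-isOptimalLA : IsOptimalLA 1 cyclic
  cyclic-isOptimalLA = covering∧separating⇒isLA cyclic covering separating , λ M B isLA →
    subst (_≤ M) (levels-fromℕ w v) (isLA⇒levels≤rows B isLA (fromℕ w))

theorem4p20 : (w v : ℕ) → 2 ≤ w → w < v → 2 * w ≤ v →
    Σ (Array v (suc w) (levels w v)) (λ A → IsOptimalLA 1 A)
-- The hypothesis w < v is implied by 2 * w ≤ v, and 2 ≤ w is only needed as w ≢ 0.
theorem4p20 w v 2≤w _ 2w≤v = cyclic , cyclic-isOptimalLA
  where
  instance
    w≢0 : NonZero w
    w≢0 = >-nonZero (≤-trans (s≤s z≤n) 2≤w)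
  open Cyclic w v (subst (_≤ v) (cong (w +_) (+-identityʳ w)) 2w≤v)
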